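{- For every positive integer $n$, \[ av'_{opt}(n,0)\ \ge\ n-2 . \]
   Context: A stack of $n$ (unburnt) pancakes is a permutation $\pi\in S_n$, $\pi(i)$ being the size of the $i$-th pancake from the top. An $i$-flip reverses the order of the top $i$ pancakes (a prefix reversal of $\pi$). $f(\pi)$ is the minimum number of flips needed to transform $\pi$ into the identity $(1,2,\dots,n)$. $av'_{opt}(n,0)$ is the average of $f(\pi)$ over all $\pi\in S_n$, i.e. the average number of flips of an optimal algorithm sorting $n$ unburnt pancakes. -}

module Defs where

open import Data.Nat using (ℕ; zero; suc; _<_)
open import Data.List using (List; []; _∷_; _++_; reverse; take; drop; map; upTo; length; concatMap)
open import Data.Product using (Σ; _×_)
open import Relation.Binary.PropositionalEquality using (_≡_)
open import Relation.Nullary using (¬_)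

-- the identity stack (1,2,...,n), top pancake first
idStack : ℕ → List ℕ
idStack n = map suc (upTo n)

insertions : ℕ → List ℕ → List (List ℕ)
insertions x []       = (x ∷ []) ∷ []
insertions x (y ∷ ys) = (x ∷ y ∷ ys) ∷ map (y ∷_) (insertions x ys)

perms : List ℕ → List (List ℕ)
perms []       = [] ∷ []
perms (x ∷ xs) = concatMap (insertions x) (perms xs)

-- S_n : all stacks of n unburnt pancakes of sizes 1..n (n! entries, no repeats)
Sn : ℕ → List (List ℕ)
Sn n = perms (idStack n)

flip : ℕ → List ℕ → List ℕ
flip i s = reverse (take i s) ++ drop i s

applyFlips : List ℕ → List ℕ → List ℕ
applyFlips []       s = s
applyFlips (i ∷ is) s = applyFlips is (flip i s)

SortableIn : ℕ → ℕ → List ℕ → Set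
SortableIn n k π = Σ (List ℕ) λ is → (length is ≡ k) × (applyFlips is π ≡ idStack n)

IsFlipNumber : ℕ → List ℕ → ℕ → Set
IsFlipNumber n π d = SortableIn n d π × (∀ k → k < d → ¬ SortableIn n k π)

-- Put the plate n + 1 under the stack. Two consecutive pancakes (or the bottom pancake and the
-- plate) form an adjacency when their sizes differ by one and a breakpoint otherwise. The sorted
-- stack has no breakpoints and a flip changes only the pair at its cut, so f(π) is at least the
-- number of breakpoints of π, which is n minus the number of adjacencies.
-- Every stack arises exactly once by inserting the smallest pancake x into some position of a
-- stack of the others. An old adjacency survives all insertions but one, and the insertions of x
-- create 2 · (neighbours of x among the others) + (1 if x neighbours the plate) ≤ 2 new ones in
-- total, since only x + 1 can neighbour x. By induction the adjacencies over S_n add up to at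
-- most 2 · n!, hence the flip numbers add up to at least (n − 2) · n!.
module Submission where

open import Data.Nat using (ℕ; zero; suc; pred; _+_; _*_; _∸_; _≤_; _≥_; z≤n; s≤s; _!)
open import Data.Nat.Properties
open import Algebra.Properties.CommutativeSemigroup +-commutativeSemigroup using (interchange)
open import Data.Nat.Solver using (module +-*-Solver)
open import Data.Nat.ListAction using (sum)
open import Data.Nat.ListAction.Properties using (sum-++; sum-↭)
open import Data.List using (List; []; _∷_; _++_; _∷ʳ_; [_]; map; length; reverse; take; drop; concatMap; applyUpTo; upTo)
open import Data.List.Properties using (length-++; length-map; map-++; map-∘; map-cong; map-cong-local; map-upTo; ++-assoc; unfold-reverse; take++drop≡id; length-upTo)
open import Data.List.Membership.Propositional using (_∈_)
open import Data.List.Relation.Unary.All as All using (All; []; _∷_)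
open import Data.List.Relation.Unary.All.Properties using (map⁺; concat⁺)
open import Data.List.Relation.Binary.Permutation.Propositional using (_↭_; ↭-refl; ↭-prep; ↭-swap; ↭-trans)
open import Data.List.Relation.Binary.Permutation.Propositional.Properties using (↭-length) renaming (map⁺ to ↭-map⁺)
import Data.Integer as ℤ
import Data.Integer.Properties as ℤ
open import Data.Product using (_×_; _,_; proj₁)
open import Data.Unit using (⊤; tt)
open import Function using (_∘_)
open import Relation.Binary.PropositionalEquality using (_≡_; refl; sym; trans; cong; cong₂; subst; module ≡-Reasoning)

open import Defs

sum-map-++ : ∀ {A : Set} (h : A → ℕ) xs ys → sum (map h (xs ++ ys)) ≡ sum (map h xs) + sum (map h ys)
sum-map-++ h xs ys = trans (cong sum (map-++ h xs ys)) (sum-++ (map h xs) (map h ys))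

sum-map-concatMap : ∀ {A B : Set} (h : B → ℕ) (g : A → List B) xs →
  sum (map h (concatMap g xs)) ≡ sum (map (λ x → sum (map h (g x))) xs)
sum-map-concatMap h g []       = refl
sum-map-concatMap h g (x ∷ xs) =
  trans (sum-map-++ h (g x) (concatMap g xs)) (cong (sum (map h (g x)) +_) (sum-map-concatMap h g xs))

length-concatMap : ∀ {A B : Set} (g : A → List B) xs → length (concatMap g xs) ≡ sum (map (length ∘ g) xs)
length-concatMap g []       = refl
length-concatMap g (x ∷ xs) = trans (length-++ (g x)) (cong (length (g x) +_) (length-concatMap g xs))

sum-map-mono : ∀ {A : Set} {h h′ : A → ℕ} {xs} → All (λ x → h x ≤ h′ x) xs → sum (map h xs) ≤ sum (map h′ xs)
sum-map-mono []             = z≤n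
sum-map-mono (hx≤ ∷ hxs≤)   = +-mono-≤ hx≤ (sum-map-mono hxs≤)

sum-map-+ : ∀ {A : Set} (h h′ : A → ℕ) xs → sum (map (λ x → h x + h′ x) xs) ≡ sum (map h xs) + sum (map h′ xs)
sum-map-+ h h′ []       = refl
sum-map-+ h h′ (x ∷ xs) = trans (cong (h x + h′ x +_) (sum-map-+ h h′ xs)) (interchange (h x) (h′ x) _ _)

sum-map-*ˡ : ∀ {A : Set} k (h : A → ℕ) xs → sum (map (λ x → k * h x) xs) ≡ k * sum (map h xs)
sum-map-*ˡ k h []       = sym (*-zeroʳ k)
sum-map-*ˡ k h (x ∷ xs) = trans (cong (k * h x +_) (sum-map-*ˡ k h xs)) (sym (*-distribˡ-+ k (h x) _))

sum-map-const : ∀ {A : Set} k (xs : List A) → sum (map (λ _ → k) xs) ≡ length xs * k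
sum-map-const k []       = refl
sum-map-const k (x ∷ xs) = cong (k +_) (sum-map-const k xs)

length-insertions : ∀ x p → length (insertions x p) ≡ suc (length p)
length-insertions x []       = refl
length-insertions x (y ∷ ys) = cong suc (trans (length-map (y ∷_) (insertions x ys)) (length-insertions x ys))

insertions-↭ : ∀ x p → All (_↭ x ∷ p) (insertions x p)
insertions-↭ x []       = ↭-refl ∷ []
insertions-↭ x (y ∷ ys) = ↭-refl ∷ map⁺ (All.map (λ q↭ → ↭-trans (↭-prep y q↭) (↭-swap y x ↭-refl)) (insertions-↭ x ys))

perms-↭ : ∀ xs → All (_↭ xs) (perms xs)
perms-↭ []       = ↭-refl ∷ []
perms-↭ (x ∷ xs) = concat⁺ (map⁺ (All.map
  (λ p↭ → All.map (λ q↭ → ↭-trans q↭ (↭-prep x p↭)) (insertions-↭ x _)) (perms-↭ xs)))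

length-perms : ∀ xs → length (perms xs) ≡ length xs !
length-perms []       = refl
length-perms (x ∷ xs) = begin
  length (concatMap (insertions x) (perms xs))         ≡⟨ length-concatMap (insertions x) (perms xs) ⟩
  sum (map (length ∘ insertions x) (perms xs))         ≡⟨ cong sum (map-cong-local (All.map length-insertions-↭ (perms-↭ xs))) ⟩
  sum (map (λ _ → suc (length xs)) (perms xs))         ≡⟨ sum-map-const (suc (length xs)) (perms xs) ⟩
  length (perms xs) * suc (length xs)                  ≡⟨ cong (_* suc (length xs)) (length-perms xs) ⟩
  length xs ! * suc (length xs)                        ≡⟨ *-comm (length xs !) (suc (length xs)) ⟩
  suc (length xs) !                                    ∎
  where
  open ≡-Reasoning
  length-insertions-↭ : ∀ {p} → p ↭ xs → length (insertions x p) ≡ suc (length xs)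
  length-insertions-↭ {p} p↭ = trans (length-insertions x p) (cong suc (↭-length p↭))

adjacent : ℕ → ℕ → ℕ
adjacent zero       (suc zero) = 1
adjacent (suc a)    (suc b)    = adjacent a b
adjacent (suc zero) zero       = 1
adjacent _          _          = 0

breakpoint : ℕ → ℕ → ℕ
breakpoint a b = 1 ∸ adjacent a b

adjacent-sym : ∀ a b → adjacent a b ≡ adjacent b a
adjacent-sym zero          zero          = refl
adjacent-sym zero          (suc zero)    = refl
adjacent-sym zero          (suc (suc b)) = refl
adjacent-sym (suc zero)    zero          = refl
adjacent-sym (suc (suc a)) zero          = refl
adjacent-sym (suc a)       (suc b)       = adjacent-sym a b

adjacent≤1 : ∀ a b → adjacent a b ≤ 1
adjacent≤1 zero             zero             = z≤n
adjacent≤1 zero             (suc zero)       = ≤-refl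
adjacent≤1 zero             (suc (suc b))    = z≤n
adjacent≤1 (suc zero)       zero             = ≤-refl
adjacent≤1 (suc (suc a))    zero             = z≤n
adjacent≤1 (suc a)          (suc b)          = adjacent≤1 a b

adjacent-suc : ∀ k → adjacent k (suc k) ≡ 1
adjacent-suc zero    = refl
adjacent-suc (suc k) = adjacent-suc k

adjacent-far : ∀ {k j} → 2 + k ≤ j → adjacent k j ≡ 0
adjacent-far {zero}  {suc (suc j)} _         = refl
adjacent-far {zero}  {suc zero}    (s≤s ())
adjacent-far {suc k} {suc j}       (s≤s 2+k≤j) = adjacent-far 2+k≤j

breakpoint-sym : ∀ a b → breakpoint a b ≡ breakpoint b a
breakpoint-sym a b = cong (1 ∸_) (adjacent-sym a b)

breakpoint≤1 : ∀ a b → breakpoint a b ≤ 1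
breakpoint≤1 a b = m∸n≤m 1 (adjacent a b)

adjacent+breakpoint≡1 : ∀ a b → adjacent a b + breakpoint a b ≡ 1
adjacent+breakpoint≡1 a b = m+[n∸m]≡n (adjacent≤1 a b)

sumConsecutive : (ℕ → ℕ → ℕ) → List ℕ → ℕ
sumConsecutive g (x ∷ y ∷ ys) = g x y + sumConsecutive g (y ∷ ys)
sumConsecutive g _            = 0

module _ (g : ℕ → ℕ → ℕ) where

  private
    S : List ℕ → ℕ
    S = sumConsecutive g

  sumConsecutive-∷-≥ : ∀ x ys → S ys ≤ S (x ∷ ys)
  sumConsecutive-∷-≥ x []       = z≤n
  sumConsecutive-∷-≥ x (y ∷ ys) = m≤n+m (S (y ∷ ys)) (g x y)

  sumConsecutive-∷-≤ : (∀ a b → g a b ≤ 1) → ∀ x ys → S (x ∷ ys) ≤ suc (S ys)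
  sumConsecutive-∷-≤ g≤1 x []       = z≤n
  sumConsecutive-∷-≤ g≤1 x (y ∷ ys) = +-monoˡ-≤ (S (y ∷ ys)) (g≤1 x y)

  sumConsecutive-++-≥ : ∀ xs ys → S xs + S ys ≤ S (xs ++ ys)
  sumConsecutive-++-≥ []           ys = ≤-refl
  sumConsecutive-++-≥ (x ∷ [])     ys = sumConsecutive-∷-≥ x ys
  sumConsecutive-++-≥ (x ∷ y ∷ zs) ys = begin
    g x y + S (y ∷ zs) + S ys   ≡⟨ +-assoc (g x y) _ _ ⟩
    g x y + (S (y ∷ zs) + S ys) ≤⟨ +-monoʳ-≤ (g x y) (sumConsecutive-++-≥ (y ∷ zs) ys) ⟩
    g x y + S (y ∷ zs ++ ys)    ∎
    where open ≤-Reasoning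

  sumConsecutive-++-≤ : (∀ a b → g a b ≤ 1) → ∀ xs ys → S (xs ++ ys) ≤ suc (S xs + S ys)
  sumConsecutive-++-≤ g≤1 []           ys = n≤1+n (S ys)
  sumConsecutive-++-≤ g≤1 (x ∷ [])     ys = sumConsecutive-∷-≤ g≤1 x ys
  sumConsecutive-++-≤ g≤1 (x ∷ y ∷ zs) ys = begin
    g x y + S (y ∷ zs ++ ys)          ≤⟨ +-monoʳ-≤ (g x y) (sumConsecutive-++-≤ g≤1 (y ∷ zs) ys) ⟩
    g x y + suc (S (y ∷ zs) + S ys)   ≡⟨ +-suc (g x y) _ ⟩
    suc (g x y + (S (y ∷ zs) + S ys)) ≡⟨ cong suc (+-assoc (g x y) _ _) ⟨
    suc (g x y + S (y ∷ zs) + S ys)   ∎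
    where open ≤-Reasoning

  sumConsecutive-++-∷ : ∀ xs y ys → S (xs ++ y ∷ ys) ≡ S (xs ∷ʳ y) + S (y ∷ ys)
  sumConsecutive-++-∷ []           y ys = refl
  sumConsecutive-++-∷ (x ∷ [])     y ys = cong (_+ S (y ∷ ys)) (sym (+-identityʳ (g x y)))
  sumConsecutive-++-∷ (x ∷ x′ ∷ xs) y ys =
    trans (cong (g x x′ +_) (sumConsecutive-++-∷ (x′ ∷ xs) y ys)) (sym (+-assoc (g x x′) _ _))

  sumConsecutive-reverse : (∀ a b → g a b ≡ g b a) → ∀ xs → S (reverse xs) ≡ S xs
  sumConsecutive-reverse g-sym []           = refl
  sumConsecutive-reverse g-sym (x ∷ [])     = refl
  sumConsecutive-reverse g-sym (x ∷ y ∷ ys) = begin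
    S (reverse (x ∷ y ∷ ys))             ≡⟨ cong S reverse-∷-∷ ⟩
    S (reverse ys ++ y ∷ [ x ])          ≡⟨ sumConsecutive-++-∷ (reverse ys) y [ x ] ⟩
    S (reverse ys ∷ʳ y) + (g y x + 0)    ≡⟨ cong₂ _+_ (cong S (sym (unfold-reverse y ys))) (trans (+-identityʳ (g y x)) (g-sym y x)) ⟩
    S (reverse (y ∷ ys)) + g x y         ≡⟨ cong (_+ g x y) (sumConsecutive-reverse g-sym (y ∷ ys)) ⟩
    S (y ∷ ys) + g x y                   ≡⟨ +-comm (S (y ∷ ys)) (g x y) ⟩
    g x y + S (y ∷ ys)                   ∎
    where
    open ≡-Reasoning
    reverse-∷-∷ : reverse (x ∷ y ∷ ys) ≡ reverse ys ++ y ∷ [ x ]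
    reverse-∷-∷ = trans (unfold-reverse x (y ∷ ys))
      (trans (cong (_∷ʳ x) (unfold-reverse y ys)) (++-assoc (reverse ys) [ y ] [ x ]))

  sumConsecutive-reverse-++ : (∀ a b → g a b ≤ 1) → (∀ a b → g a b ≡ g b a) →
                              ∀ xs ys → S (xs ++ ys) ≤ suc (S (reverse xs ++ ys))
  sumConsecutive-reverse-++ g≤1 g-sym xs ys = begin
    S (xs ++ ys)                ≤⟨ sumConsecutive-++-≤ g≤1 xs ys ⟩
    suc (S xs + S ys)           ≡⟨ cong (λ s → suc (s + S ys)) (sumConsecutive-reverse g-sym xs) ⟨
    suc (S (reverse xs) + S ys) ≤⟨ s≤s (sumConsecutive-++-≥ (reverse xs) ys) ⟩
    suc (S (reverse xs ++ ys))  ∎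
    where open ≤-Reasoning

-- c is the plate under the stack.
breakpoints : ℕ → List ℕ → ℕ
breakpoints c s = sumConsecutive breakpoint (s ∷ʳ c)

breakpoints-flip : ∀ c i s → breakpoints c s ≤ suc (breakpoints c (flip i s))
breakpoints-flip c i s = begin
  S (s ∷ʳ c)                   ≡⟨ cong (λ t → S (t ∷ʳ c)) (take++drop≡id i s) ⟨
  S ((T ++ D) ∷ʳ c)            ≡⟨ cong S (++-assoc T D [ c ]) ⟩
  S (T ++ D ∷ʳ c)              ≤⟨ sumConsecutive-reverse-++ breakpoint breakpoint≤1 breakpoint-sym T (D ∷ʳ c) ⟩
  suc (S (reverse T ++ D ∷ʳ c)) ≡⟨ cong (suc ∘ S) (++-assoc (reverse T) D [ c ]) ⟨
  suc (breakpoints c (flip i s)) ∎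
  where
  open ≤-Reasoning
  S = sumConsecutive breakpoint
  T = take i s
  D = drop i s

ascendingRun : ℕ → ℕ → List ℕ
ascendingRun k zero    = []
ascendingRun k (suc m) = k ∷ ascendingRun (suc k) m

applyUpTo-ascendingRun : ∀ {f : ℕ → ℕ} k m → (∀ i → f i ≡ k + i) → applyUpTo f m ≡ ascendingRun k m
applyUpTo-ascendingRun k zero    f≗k+ = refl
applyUpTo-ascendingRun k (suc m) f≗k+ = cong₂ _∷_ (trans (f≗k+ 0) (+-identityʳ k))
  (applyUpTo-ascendingRun (suc k) m (λ i → trans (f≗k+ (suc i)) (+-suc k i)))

idStack-ascendingRun : ∀ n → idStack n ≡ ascendingRun 1 n
idStack-ascendingRun n = trans (map-upTo suc n) (applyUpTo-ascendingRun 1 n (λ i → refl))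

length-idStack : ∀ n → length (idStack n) ≡ n
length-idStack n = trans (length-map suc (upTo n)) (length-upTo n)

ascendingRun-∷ʳ : ∀ k m → ascendingRun k m ∷ʳ (k + m) ≡ ascendingRun k (suc m)
ascendingRun-∷ʳ k zero    = cong [_] (+-identityʳ k)
ascendingRun-∷ʳ k (suc m) = cong (k ∷_) (trans (cong (ascendingRun (suc k) m ∷ʳ_) (+-suc k m)) (ascendingRun-∷ʳ (suc k) m))

sumConsecutive-breakpoint-ascendingRun : ∀ k m → sumConsecutive breakpoint (ascendingRun k m) ≡ 0
sumConsecutive-breakpoint-ascendingRun k zero          = refl
sumConsecutive-breakpoint-ascendingRun k (suc zero)    = refl
sumConsecutive-breakpoint-ascendingRun k (suc (suc m)) =
  cong₂ _+_ (cong (1 ∸_) (adjacent-suc k)) (sumConsecutive-breakpoint-ascendingRun (suc k) (suc m))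

breakpoints-idStack : ∀ n → breakpoints (suc n) (idStack n) ≡ 0
breakpoints-idStack n = begin
  S (idStack n ∷ʳ suc n)        ≡⟨ cong (λ t → S (t ∷ʳ suc n)) (idStack-ascendingRun n) ⟩
  S (ascendingRun 1 n ∷ʳ suc n) ≡⟨ cong S (ascendingRun-∷ʳ 1 n) ⟩
  S (ascendingRun 1 (suc n))    ≡⟨ sumConsecutive-breakpoint-ascendingRun 1 (suc n) ⟩
  0                             ∎
  where
  open ≡-Reasoning
  S = sumConsecutive breakpoint

breakpoints≤length-flips : ∀ n is s → applyFlips is s ≡ idStack n → breakpoints (suc n) s ≤ length is
breakpoints≤length-flips n []       s refl   = ≤-reflexive (breakpoints-idStack n)
breakpoints≤length-flips n (i ∷ is) s sorted =
  ≤-trans (breakpoints-flip (suc n) i s) (s≤s (breakpoints≤length-flips n is (flip i s) sorted))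

breakpoints≤flipNumber : ∀ {n d π} → SortableIn n d π → breakpoints (suc n) π ≤ d
breakpoints≤flipNumber {n} {π = π} (is , refl , sorted) = breakpoints≤length-flips n is π sorted

adjacencies : ℕ → List ℕ → ℕ
adjacencies c s = sumConsecutive adjacent (s ∷ʳ c)

sumConsecutive-adjacent+breakpoint : ∀ xs → sumConsecutive adjacent xs + sumConsecutive breakpoint xs ≡ pred (length xs)
sumConsecutive-adjacent+breakpoint []           = refl
sumConsecutive-adjacent+breakpoint (x ∷ [])     = refl
sumConsecutive-adjacent+breakpoint (x ∷ y ∷ ys) = begin
  (adjacent x y + sumConsecutive adjacent (y ∷ ys)) + (breakpoint x y + sumConsecutive breakpoint (y ∷ ys))
    ≡⟨ interchange (adjacent x y) _ (breakpoint x y) _ ⟩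
  (adjacent x y + breakpoint x y) + (sumConsecutive adjacent (y ∷ ys) + sumConsecutive breakpoint (y ∷ ys))
    ≡⟨ cong₂ _+_ (adjacent+breakpoint≡1 x y) (sumConsecutive-adjacent+breakpoint (y ∷ ys)) ⟩
  suc (length ys) ∎
  where open ≡-Reasoning

adjacencies+breakpoints : ∀ c s → adjacencies c s + breakpoints c s ≡ length s
adjacencies+breakpoints c s = trans (sumConsecutive-adjacent+breakpoint (s ∷ʳ c))
  (cong pred (trans (length-++ s) (+-comm (length s) 1)))

neighbours : ℕ → List ℕ → ℕ
neighbours x xs = sum (map (adjacent x) xs)

neighbours-∷ʳ : ∀ x xs c → neighbours x (xs ∷ʳ c) ≡ neighbours x xs + adjacent x c
neighbours-∷ʳ x xs c = trans (sum-map-++ (adjacent x) xs [ c ]) (cong (neighbours x xs +_) (+-identityʳ (adjacent x c)))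

neighbours-↭ : ∀ x {p xs} → p ↭ xs → neighbours x p ≡ neighbours x xs
neighbours-↭ x p↭ = sum-↭ (↭-map⁺ (adjacent x) p↭)

headOr : ℕ → List ℕ → ℕ
headOr c []      = c
headOr c (x ∷ _) = x

adjacencies-∷ : ∀ c y ys → adjacencies c (y ∷ ys) ≡ adjacent y (headOr c ys) + adjacencies c ys
adjacencies-∷ c y []      = refl
adjacencies-∷ c y (_ ∷ _) = refl

sum-adjacent-headOr-insertions : ∀ c x y ys →
  sum (map (adjacent y ∘ headOr c) (insertions x ys)) ≡ adjacent y x + length ys * adjacent y (headOr c ys)
sum-adjacent-headOr-insertions c x y []       = refl
sum-adjacent-headOr-insertions c x y (z ∷ zs) = cong (adjacent y x +_) (begin
  sum (map (adjacent y ∘ headOr c) (map (z ∷_) (insertions x zs))) ≡⟨ cong sum (map-∘ (insertions x zs)) ⟨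
  sum (map (λ _ → adjacent y z) (insertions x zs))                 ≡⟨ sum-map-const (adjacent y z) (insertions x zs) ⟩
  length (insertions x zs) * adjacent y z                          ≡⟨ cong (_* adjacent y z) (length-insertions x zs) ⟩
  suc (length zs) * adjacent y z                                   ∎)
  where open ≡-Reasoning

sum-adjacencies-insertions : ∀ c x p →
  sum (map (adjacencies c) (insertions x p)) ≡ length p * adjacencies c p + (2 * neighbours x p + adjacent x c)
sum-adjacencies-insertions c x []       = trans (+-identityʳ _) (+-identityʳ (adjacent x c))
sum-adjacencies-insertions c x (y ∷ ys) = begin
  (X + Ay) + sum (map A (map (y ∷_) (insertions x ys)))
    ≡⟨ cong ((X + Ay) +_) sum-extensions ⟩
  (X + Ay) + (sum (map (adjacent y ∘ headOr c) (insertions x ys)) + sum (map A (insertions x ys)))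
    ≡⟨ cong₂ (λ u v → (X + u) + v) (adjacencies-∷ c y ys)
             (cong₂ _+_ (sum-adjacent-headOr-insertions c x y ys) (sum-adjacencies-insertions c x ys)) ⟩
  (X + (a + As)) + ((adjacent y x + m * a) + (m * As + (2 * N + R)))
    ≡⟨ cong (λ u → (X + (a + As)) + ((u + m * a) + (m * As + (2 * N + R)))) (adjacent-sym y x) ⟩
  (X + (a + As)) + ((X + m * a) + (m * As + (2 * N + R)))
    ≡⟨ solve 6 (λ X a As m N R → (X :+ (a :+ As)) :+ ((X :+ m :* a) :+ (m :* As :+ (con 2 :* N :+ R)))
                  := (con 1 :+ m) :* (a :+ As) :+ (con 2 :* (X :+ N) :+ R)) refl X a As m N R ⟩
  suc m * (a + As) + (2 * (X + N) + R)
    ≡⟨ cong (λ u → suc m * u + (2 * (X + N) + R)) (adjacencies-∷ c y ys) ⟨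
  suc m * Ay + (2 * (X + N) + R) ∎
  where
  open ≡-Reasoning
  open +-*-Solver
  A = adjacencies c
  Ay = A (y ∷ ys)
  X = adjacent x y
  a = adjacent y (headOr c ys)
  As = A ys
  m = length ys
  N = neighbours x ys
  R = adjacent x c
  I = insertions x ys
  sum-extensions : sum (map A (map (y ∷_) I)) ≡ sum (map (adjacent y ∘ headOr c) I) + sum (map A I)
  sum-extensions = trans (cong sum (sym (map-∘ I)))
    (trans (cong sum (map-cong (adjacencies-∷ c y) I)) (sum-map-+ (adjacent y ∘ headOr c) A I))

AtMostOneNeighbourBelow : ℕ → List ℕ → Set
AtMostOneNeighbourBelow c []       = ⊤
AtMostOneNeighbourBelow c (x ∷ xs) = neighbours x (xs ∷ʳ c) ≤ 1 × AtMostOneNeighbourBelow c xs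

sum-adjacencies-perms : ∀ c xs → AtMostOneNeighbourBelow c xs →
                        sum (map (adjacencies c) (perms xs)) ≤ 2 * length xs !
sum-adjacencies-perms c []       _                    = z≤n
sum-adjacencies-perms c (x ∷ xs) (x-below , xs-below) = begin
  sum (map A (concatMap (insertions x) P))            ≡⟨ sum-map-concatMap A (insertions x) P ⟩
  sum (map (λ p → sum (map A (insertions x p))) P)    ≤⟨ sum-map-mono (All.map sum-insertions≤ (perms-↭ xs)) ⟩
  sum (map (λ p → m * A p + 2) P)                     ≡⟨ sum-map-+ (λ p → m * A p) (λ _ → 2) P ⟩
  sum (map (λ p → m * A p) P) + sum (map (λ _ → 2) P) ≡⟨ cong₂ _+_ (sum-map-*ˡ m A P) (sum-map-const 2 P) ⟩
  m * sum (map A P) + length P * 2                    ≤⟨ +-mono-≤ (*-monoʳ-≤ m (sum-adjacencies-perms c xs xs-below))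
                                                                   (≤-reflexive (cong (_* 2) (length-perms xs))) ⟩
  m * (2 * m !) + m ! * 2                             ≡⟨ solve 2 (λ m f → m :* (con 2 :* f) :+ f :* con 2
                                                                       := con 2 :* (f :+ m :* f)) refl m (m !) ⟩
  2 * suc m !                                         ∎
  where
  open ≤-Reasoning
  open +-*-Solver
  A = adjacencies c
  P = perms xs
  m = length xs
  new-adjacencies≤2 : 2 * neighbours x xs + adjacent x c ≤ 2
  new-adjacencies≤2 = begin
    2 * neighbours x xs + adjacent x c         ≤⟨ +-monoʳ-≤ (2 * neighbours x xs) (m≤m+n (adjacent x c) _) ⟩
    2 * neighbours x xs + 2 * adjacent x c     ≡⟨ *-distribˡ-+ 2 (neighbours x xs) (adjacent x c) ⟨
    2 * (neighbours x xs + adjacent x c)       ≡⟨ cong (2 *_) (neighbours-∷ʳ x xs c) ⟨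
    2 * neighbours x (xs ∷ʳ c)                 ≤⟨ *-monoʳ-≤ 2 x-below ⟩
    2                                          ∎
  sum-insertions≤ : ∀ {p} → p ↭ xs → sum (map A (insertions x p)) ≤ m * A p + 2
  sum-insertions≤ {p} p↭ = begin
    sum (map A (insertions x p))                            ≡⟨ sum-adjacencies-insertions c x p ⟩
    length p * A p + (2 * neighbours x p + adjacent x c)    ≡⟨ cong₂ (λ l k → l * A p + (2 * k + adjacent x c))
                                                                      (↭-length p↭) (neighbours-↭ x p↭) ⟩
    m * A p + (2 * neighbours x xs + adjacent x c)          ≤⟨ +-monoʳ-≤ (m * A p) new-adjacencies≤2 ⟩
    m * A p + 2                                             ∎

neighbours-ascendingRun-far : ∀ {k j} m → 2 + k ≤ j → neighbours k (ascendingRun j m) ≡ 0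
neighbours-ascendingRun-far zero    _     = refl
neighbours-ascendingRun-far (suc m) 2+k≤j = cong₂ _+_ (adjacent-far 2+k≤j) (neighbours-ascendingRun-far m (m≤n⇒m≤1+n 2+k≤j))

ascendingRun-atMostOneNeighbourBelow : ∀ k m → AtMostOneNeighbourBelow (k + m) (ascendingRun k m)
ascendingRun-atMostOneNeighbourBelow k zero    = tt
ascendingRun-atMostOneNeighbourBelow k (suc m) =
  ≤-reflexive neighbours≡1 ,
  subst (λ c → AtMostOneNeighbourBelow c (ascendingRun (suc k) m)) (sym (+-suc k m))
    (ascendingRun-atMostOneNeighbourBelow (suc k) m)
  where
  neighbours≡1 : neighbours k (ascendingRun (suc k) m ∷ʳ (k + suc m)) ≡ 1
  neighbours≡1 = begin
    neighbours k (ascendingRun (suc k) m ∷ʳ (k + suc m))  ≡⟨ cong (λ c → neighbours k (ascendingRun (suc k) m ∷ʳ c)) (+-suc k m) ⟩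
    neighbours k (ascendingRun (suc k) m ∷ʳ (suc k + m))  ≡⟨ cong (neighbours k) (ascendingRun-∷ʳ (suc k) m) ⟩
    adjacent k (suc k) + neighbours k (ascendingRun (2 + k) m)
      ≡⟨ cong₂ _+_ (adjacent-suc k) (neighbours-ascendingRun-far m ≤-refl) ⟩
    1                                                     ∎
    where open ≡-Reasoning

sum-adjacencies-Sn : ∀ n → sum (map (adjacencies (suc n)) (Sn n)) ≤ 2 * n !
sum-adjacencies-Sn n = subst (λ l → sum (map (adjacencies (suc n)) (Sn n)) ≤ 2 * l !) (length-idStack n)
  (sum-adjacencies-perms (suc n) (idStack n)
    (subst (AtMostOneNeighbourBelow (suc n)) (sym (idStack-ascendingRun n)) (ascendingRun-atMostOneNeighbourBelow 1 n)))

sum-breakpoints-Sn-≥ : ∀ n → n * n ! ≤ 2 * n ! + sum (map (breakpoints (suc n)) (Sn n))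
sum-breakpoints-Sn-≥ n = begin
  n * n !                                     ≡⟨ *-comm n (n !) ⟩
  n ! * n                                     ≡⟨ cong (_* n) (trans (length-perms (idStack n)) (cong _! (length-idStack n))) ⟨
  length (Sn n) * n                           ≡⟨ sum-map-const n (Sn n) ⟨
  sum (map (λ _ → n) (Sn n))                  ≡⟨ cong sum (map-cong-local (All.map adjacencies+breakpoints≡n (perms-↭ (idStack n)))) ⟨
  sum (map (λ π → A π + B π) (Sn n))          ≡⟨ sum-map-+ A B (Sn n) ⟩
  sum (map A (Sn n)) + sum (map B (Sn n))     ≤⟨ +-monoˡ-≤ (sum (map B (Sn n))) (sum-adjacencies-Sn n) ⟩
  2 * n ! + sum (map B (Sn n))                ∎
  where
  open ≤-Reasoning
  A = adjacencies (suc n)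
  B = breakpoints (suc n)
  adjacencies+breakpoints≡n : ∀ {π} → π ↭ idStack n → A π + B π ≡ n
  adjacencies+breakpoints≡n {π} π↭ =
    trans (adjacencies+breakpoints (suc n) π) (trans (↭-length π↭) (length-idStack n))

-- For n ≤ 1 the left-hand side is negative.
mainTheorem6 : (n : ℕ) → n ≥ 1 → (f : List ℕ → ℕ) →
    (∀ π → π ∈ Sn n → IsFlipNumber n π (f π)) →
    (ℤ.+ n ℤ.- ℤ.+ 2) ℤ.* ℤ.+ (n !) ℤ.≤ ℤ.+ sum (map f (Sn n))
mainTheorem6 zero            _ _ _ = ℤ.-≤+
mainTheorem6 (suc zero)      _ _ _ = ℤ.-≤+
mainTheorem6 n@(suc (suc k)) _ f isFlipNumber =
  subst (ℤ._≤ ℤ.+ sum (map f (Sn n))) (ℤ.pos-* k (n !)) (ℤ.+≤+ (+-cancelˡ-≤ (2 * n !) _ _ (begin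
    2 * n ! + k * n !                                ≡⟨ *-distribʳ-+ (n !) 2 k ⟨
    n * n !                                          ≤⟨ sum-breakpoints-Sn-≥ n ⟩
    2 * n ! + sum (map (breakpoints (suc n)) (Sn n)) ≤⟨ +-monoʳ-≤ (2 * n !) (sum-map-mono (All.tabulate breakpoints≤f)) ⟩
    2 * n ! + sum (map f (Sn n))                     ∎)))
  where
  open ≤-Reasoning
  breakpoints≤f : ∀ {π} → π ∈ Sn n → breakpoints (suc n) π ≤ f π
  breakpoints≤f π∈Sn = breakpoints≤flipNumber (proj₁ (isFlipNumber _ π∈Sn))
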